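{- Let $\beta=(E,\#,\mapsto,l)$ be a Bundle Event Structure and let $e,e'\in E$ be such that there exists $X\subseteq E$ with $e\in X$ and $X\mapsto e'$. Then for every trace $\sigma=e_1\cdots e_n$ of $\beta$ there is no $i<n$ with $e\in\mathrm{en}_\beta(\sigma_i)$ and $e'\in\mathrm{en}_\beta(\sigma_i)$.
   Context: A Bundle Event Structure (BES) is a quadruple $\beta=(E,\#,\mapsto,l)$ where $E$ is a set of events, $\#\subseteq E\times E$ is an irreflexive symmetric relation (conflict), $\mapsto\subseteq\mathcal{P}(E)\times E$ is the enabling relation (a pair $(X,e)$ is written $X\mapsto e$ and called a bundle), and $l:E\to Act$ is a labeling function, satisfying Stability: whenever $X\mapsto e$, any two distinct $e_1,e_2\in X$ satisfy $e_1\# e_2$. For a finite sequence $\sigma=e_1\cdots e_n$ of events write $\bar\sigma=\{e_1,\dots,e_n\}$ and $\sigma_i=e_1\cdots e_i$ ($\sigma_0$ empty). Define $\mathrm{en}_\beta(\sigma)=\{e\in E\setminus\bar\sigma\mid (\forall X\subseteq E.\ X\mapsto e\Rightarrow X\cap\bar\sigma\neq\emptyset)\wedge\neg\exists e'\in\bar\sigma.\ e\# e'\}$. The sequence $\sigma$ is a trace of $\beta$ iff $e_i\in\mathrm{en}_\beta(\sigma_{i-1})$ for all $1\le i\le n$. -}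

module Defs where

open import Level using (Level; _⊔_; suc)
open import Data.List using (List; []; _∷_; take; length; lookup)
open import Data.Fin using (Fin; toℕ)
open import Data.List.Membership.Propositional using (_∈_; _∉_)
open import Data.Product using (Σ; _×_; _,_)
open import Relation.Nullary using (¬_)
open import Relation.Binary.PropositionalEquality using (_≡_)

record BES (E : Set) (Act : Set) : Set₁ where
  field
    _#_       : E → E → Set
    _↦_       : (E → Set) → E → Set
    l         : E → Act
    #-irrefl  : ∀ {e} → ¬ (e # e)
    #-sym     : ∀ {e₁ e₂} → e₁ # e₂ → e₂ # e₁
    stability : ∀ {X e} → X ↦ e → ∀ {e₁ e₂} → X e₁ → X e₂ → ¬ (e₁ ≡ e₂) → e₁ # e₂

module _ {E Act : Set} (β : BES E Act) where
  open BES β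

  en : List E → E → Set₁
  en σ e = (e ∉ σ)
         × (∀ (X : E → Set) → X ↦ e → Σ E (λ x → X x × x ∈ σ))
         × (¬ Σ E (λ e' → e' ∈ σ × (e # e')))

  -- σ = e₁ ⋯ eₙ is a trace iff e_{i+1} ∈ en(σ_i) for all 0 ≤ i < n,
  -- where σ_i = take i σ and e_{i+1} = lookup σ i (0-based Fin index).
  IsTrace : List E → Set₁
  IsTrace σ = ∀ (i : Fin (length σ)) → en (take (toℕ i) σ) (lookup σ i)

module Submission where

open import Defs
open import Data.List using (List; take; length)
open import Data.List.Membership.Propositional using (_∈_)
open import Data.Nat using (ℕ; _<_)
open import Data.Product using (Σ; _×_; _,_)
open import Relation.Binary.PropositionalEquality using (_≡_; sym; subst)
open import Relation.Nullary using (¬_)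

-- Enabling e' forces some x ∈ X into σ; enabling e keeps e out of σ, so
-- x ≠ e and stability puts e in conflict with x ∈ σ, which contradicts
-- enabling e.

module _ {E Act : Set} (β : BES E Act) where
  open BES β

  en-∉ : ∀ {σ e} → en β σ e → ¬ e ∈ σ
  en-∉ (e∉σ , _ , _) = e∉σ

  en-bundle-meets : ∀ {σ X e} → en β σ e → X ↦ e → Σ E (λ x → X x × x ∈ σ)
  en-bundle-meets (_ , meets , _) = meets _

  en-conflict-free : ∀ {σ e x} → en β σ e → x ∈ σ → ¬ (e # x)
  en-conflict-free (_ , _ , free) x∈σ e#x = free (_ , x∈σ , e#x)

  en-bundle-exclusive : ∀ {σ X e e'} → X e → X ↦ e'
                      → en β σ e → ¬ en β σ e'
  en-bundle-exclusive {σ} Xe X↦e' en-e en-e'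
    with en-bundle-meets en-e' X↦e'
  ... | x , Xx , x∈σ = en-conflict-free en-e x∈σ (stability X↦e' Xe Xx e≢x)
    where
    e≢x : ¬ _ ≡ x
    e≢x e≡x = en-∉ en-e (subst (_∈ σ) (sym e≡x) x∈σ)

lemma1 : {E Act : Set} (β : BES E Act) (e e' : E)
    → Σ (E → Set) (λ X → X e × BES._↦_ β X e')
    → (σ : List E) → IsTrace β σ
    → ¬ Σ ℕ (λ i → i < length σ × en β (take i σ) e × en β (take i σ) e')
lemma1 β e e' (X , Xe , X↦e') σ _ (i , _ , en-e , en-e') =
  en-bundle-exclusive β Xe X↦e' en-e en-e'
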